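{- Let $\vec H$ be a digraph with $\alpha_s(\vec H)\le c$, and let $\vec H'$ be a quotient of an arc supergraph of $\vec H$. Then the reachability hypergraph $\mathcal R(\vec H')$ has at most $c$ hyperedges.
   Context: Digraphs are finite, no multiple arcs, loops allowed. $\vec H/\!\sim$ is the DAG obtained by contracting each strongly connected component (SCC) of $\vec H$ to a vertex and deleting loops; $\alpha_s(\vec H)$ is the number of its sources (indegree-$0$ vertices). $\vec H_2$ is an arc supergraph of $\vec H_1$ if they have the same vertex set and $E(\vec H_1)\subseteq E(\vec H_2)$. A quotient w.r.t. a partition $\sigma$ of the vertex set has the blocks as vertices and an arc $(B_1,B_2)$ (possibly a loop) iff some arc goes from $B_1$ to $B_2$. The reachability hypergraph $\mathcal R(\vec H')$ has vertex set $V(\vec H')$ and, for each source $S_i$ of $\vec H'/\!\sim$ with chosen $s_i\in S_i$, the hyperedge $R(s_i)$ of vertices reachable from $s_i$. -}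

module Defs where

open import Data.Nat using (ℕ; suc)
open import Data.Fin using (Fin; _≟_)
open import Data.Fin.Properties using (any?)
open import Data.Product using (Σ; ∃; _×_; _,_)
open import Relation.Nullary using (¬_; Dec)
open import Relation.Nullary.Decidable using (_×-dec_)
open import Relation.Binary using (Rel; Decidable)
open import Relation.Binary.PropositionalEquality using (_≡_)
open import Relation.Binary.Construct.Closure.ReflexiveTransitive using (Star)
open import Function.Definitions using (Surjective)
open import Data.Empty using (⊥)

-- A finite digraph on vertex set Fin n; at most one arc per ordered pair
-- (arcs form a relation), loops allowed; arc relation decidable.
record Digraph : Set₁ where
  field
    n    : ℕ
    Arc  : Rel (Fin n) _
    arc? : Decidable Arc
open Digraph public

Reach : (H : Digraph) → Fin (n H) → Fin (n H) → Set
Reach H = Star (Arc H)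

SameSCC : (H : Digraph) → Fin (n H) → Fin (n H) → Set
SameSCC H u v = Reach H u v × Reach H v u

-- the SCC of s is a source of H/~ : no arc enters it from another SCC
InSourceSCC : (H : Digraph) → Fin (n H) → Set
InSourceSCC H s = ∀ u v → Arc H u v → SameSCC H v s → SameSCC H u s

-- α_s(H) ≤ c : there are no c+1 vertices lying in pairwise distinct source SCCs
SourcesAtMost : Digraph → ℕ → Set
SourcesAtMost H c =
  (f : Fin (suc c) → Fin (n H)) →
  (∀ i → InSourceSCC H (f i)) →
  (∀ i j → SameSCC H (f i) (f j) → i ≡ j) → ⊥

ArcSupergraph : (H₁ H₂ : Digraph) → Set
ArcSupergraph H₁ H₂ =
  Σ (n H₁ ≡ n H₂) λ { _≡_.refl → ∀ u v → Arc H₁ u v → Arc H₂ u v }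

-- Quotient of H w.r.t. the partition given by the blocks (fibres) of a
-- surjective map q : Fin (n H) → Fin m; arc (B₁,B₂) iff some arc goes
-- from block B₁ to block B₂ (loops possible).
QArc : (H : Digraph) (m : ℕ) (q : Fin (n H) → Fin m) → Rel (Fin m) _
QArc H m q B₁ B₂ = ∃ λ u → ∃ λ v → (q u ≡ B₁ × q v ≡ B₂) × Arc H u v

QArc? : (H : Digraph) (m : ℕ) (q : Fin (n H) → Fin m) → Decidable (QArc H m q)
QArc? H m q B₁ B₂ =
  any? λ u → any? λ v → ((q u ≟ B₁) ×-dec (q v ≟ B₂)) ×-dec arc? H u v

Quotient : (H : Digraph) (m : ℕ) (q : Fin (n H) → Fin m) → Digraph
Quotient H m q = record { n = m ; Arc = QArc H m q ; arc? = QArc? H m q }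

-- hyperedge R(s) of the reachability hypergraph, for s in a source SCC
-- two hyperedges are equal when they are the same vertex set
SameHyperedge : (H : Digraph) → Fin (n H) → Fin (n H) → Set
SameHyperedge H s t = ∀ v → (Reach H s v → Reach H t v) × (Reach H t v → Reach H s v)

-- the reachability hypergraph R(H) has at most c hyperedges:
-- there are no c+1 pairwise distinct hyperedges R(s₀),…,R(s_c)
-- with each s_i in a source SCC of H.
ReachHypergraphAtMost : Digraph → ℕ → Set
ReachHypergraphAtMost H c =
  (f : Fin (suc c) → Fin (n H)) →
  (∀ i → InSourceSCC H (f i)) →
  (∀ i j → SameHyperedge H (f i) (f j) → i ≡ j) → ⊥

{-# OPTIONS --safe #-}
module Submission where

-- Lift each of c + 1 source vertices tᵢ of H′ with pairwise distinct hyperedges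
-- along the surjection V(H) → V(H′), and pick a vertex sᵢ of a source SCC of H
-- reaching the lift (one exists since strict reachability is well founded on a
-- finite vertex set). The image of sᵢ reaches tᵢ, and an SCC that is a source
-- absorbs everything reaching it, so sᵢ lands in the SCC of tᵢ. Distinct
-- hyperedges lie in distinct SCCs, so the sᵢ lie in c + 1 distinct source SCCs.

open import Data.Nat using (ℕ)
open import Data.Fin using (Fin; zero; suc)
open import Data.Fin.Properties using (any?; ∀-cons)
open import Data.Fin.Induction using (spo-wellFounded)
open import Data.Product using (∃; ∃₂; _×_; _,_; proj₁; proj₂)
open import Data.Sum using (_⊎_; inj₁; inj₂)
open import Function using (id; _∘_)
open import Function.Definitions using (Surjective)
open import Induction.WellFounded using (Acc; acc)
open import Relation.Binary using (Decidable; IsStrictPartialOrder)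
open import Relation.Binary.PropositionalEquality
  using (_≡_; refl; cong; trans; resp₂; isEquivalence)
open import Relation.Binary.Construct.Closure.ReflexiveTransitive
  using (ε; _◅_; _◅◅_; gmap)
open import Relation.Nullary using (¬_; yes; no)
open import Relation.Nullary.Decidable
  using (_×-dec_; ¬?; decidable-stable; ¬¬-excluded-middle)
open import Relation.Nullary.Negation using (DoubleNegation)
open import Defs

¬¬-∀-Fin : ∀ {k} {P : Fin k → Set} →
           (∀ i → DoubleNegation (P i)) → DoubleNegation (∀ i → P i)
¬¬-∀-Fin {ℕ.zero}  h k = k λ ()
¬¬-∀-Fin {ℕ.suc _} h k = h zero λ p₀ → ¬¬-∀-Fin (h ∘ suc) (k ∘ ∀-cons p₀)

module _ (G : Digraph) where

  SameSCC-sym : ∀ {u v} → SameSCC G u v → SameSCC G v u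
  SameSCC-sym (uv , vu) = vu , uv

  SameSCC-trans : ∀ {u v w} → SameSCC G u v → SameSCC G v w → SameSCC G u w
  SameSCC-trans (uv , vu) (vw , wv) = uv ◅◅ vw , wv ◅◅ vu

  SameSCC⇒SameHyperedge : ∀ {u v} → SameSCC G u v → SameHyperedge G u v
  SameSCC⇒SameHyperedge (uv , vu) _ = vu ◅◅_ , uv ◅◅_

  Reach-source⇒SameSCC : ∀ {u s} → InSourceSCC G s → Reach G u s → SameSCC G u s
  Reach-source⇒SameSCC s-src ε = ε , ε
  Reach-source⇒SameSCC s-src (uv ◅ vs) =
    s-src _ _ uv (Reach-source⇒SameSCC s-src vs)

  HasSourceAncestor : Fin (n G) → Set
  HasSourceAncestor u = ∃ λ s → InSourceSCC G s × Reach G s u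

  _⊏_ : Fin (n G) → Fin (n G) → Set
  w ⊏ u = Reach G w u × ¬ Reach G u w

  ⊏-isStrictPartialOrder : IsStrictPartialOrder _≡_ _⊏_
  ⊏-isStrictPartialOrder = record
    { isEquivalence = isEquivalence
    ; irrefl        = λ { refl (_ , ¬uu) → ¬uu ε }
    ; trans         = λ (uv , ¬vu) (vw , _) → uv ◅◅ vw , λ wu → ¬vu (vw ◅◅ wu)
    ; <-resp-≈      = resp₂ _⊏_
    }

  module _ (reach? : Decidable (Reach G)) where

    sameSCC? : Decidable (SameSCC G)
    sameSCC? u v = reach? u v ×-dec reach? v u

    source-or-entered : ∀ s → InSourceSCC G s ⊎
      ∃₂ λ u v → Arc G u v × SameSCC G v s × ¬ SameSCC G u s
    source-or-entered s
      with any? (λ u → any? λ v → arc? G u v ×-dec sameSCC? v s ×-dec ¬? (sameSCC? u s))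
    ... | yes entering = inj₂ entering
    ... | no ¬entering = inj₁ λ u v uv vs →
          decidable-stable (sameSCC? u s) λ ¬us → ¬entering (u , v , uv , vs , ¬us)

    source-ancestor : ∀ u → HasSourceAncestor u
    source-ancestor u = go u (spo-wellFounded ⊏-isStrictPartialOrder u)
      where
      go : ∀ u → Acc _⊏_ u → HasSourceAncestor u
      go u (acc below) with source-or-entered u
      ... | inj₁ u-src = u , u-src , ε
      ... | inj₂ (w , v , wv , (vu , _) , ¬wu) =
            let wu = wv ◅ vu
                (s , s-src , sw) = go w (below (wu , λ uw → ¬wu (wu , uw)))
            in  s , s-src , sw ◅◅ wu

record Epimorphism (G H : Digraph) : Set where
  field
    vertex     : Fin (n G) → Fin (n H)
    arc        : ∀ {u v} → Arc G u v → Arc H (vertex u) (vertex v)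
    surjective : ∀ y → ∃ λ x → vertex x ≡ y

  reach : ∀ {u v} → Reach G u v → Reach H (vertex u) (vertex v)
  reach = gmap vertex arc

  sameSCC : ∀ {u v} → SameSCC G u v → SameSCC H (vertex u) (vertex v)
  sameSCC (uv , vu) = reach uv , reach vu

_∘ᴱ_ : ∀ {G H K} → Epimorphism H K → Epimorphism G H → Epimorphism G K
ψ ∘ᴱ φ = record
  { vertex     = ψ.vertex ∘ φ.vertex
  ; arc        = ψ.arc ∘ φ.arc
  ; surjective = λ z →
      let (y , ψy≡z) = ψ.surjective z
          (x , φx≡y) = φ.surjective y
      in  x , trans (cong ψ.vertex φx≡y) ψy≡z
  }
  where
  module φ = Epimorphism φ
  module ψ = Epimorphism ψ

ArcSupergraph⇒Epimorphism : ∀ {G H} → ArcSupergraph G H → Epimorphism G H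
ArcSupergraph⇒Epimorphism {record {}} {record {}} (refl , ⊆) = record
  { vertex     = id
  ; arc        = ⊆ _ _
  ; surjective = λ y → y , refl
  }

quotient-epimorphism : ∀ H m {q : Fin (n H) → Fin m} → Surjective _≡_ _≡_ q →
                       Epimorphism H (Quotient H m q)
quotient-epimorphism H m {q} q-surj = record
  { vertex     = q
  ; arc        = λ {u} {v} uv → u , v , (refl , refl) , uv
  ; surjective = λ y → proj₁ (q-surj y) , proj₂ (q-surj y) refl
  }

module _ {G H : Digraph} (φ : Epimorphism G H) where
  open Epimorphism φ

  source-preimage : Decidable (Reach G) → ∀ {t} → InSourceSCC H t →
                    ∃ λ s → InSourceSCC G s × SameSCC H (vertex s) t
  source-preimage reach? {t} t-src with surjective t
  ... | x , refl =
    let (s , s-src , sx) = source-ancestor G reach? x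
    in  s , s-src , Reach-source⇒SameSCC H t-src (reach sx)

  ReachHypergraphAtMost-image : ∀ {c} → SourcesAtMost G c → ReachHypergraphAtMost H c
  ReachHypergraphAtMost-image sources≤c t t-src t-distinct =
    -- the conclusion is a negation, so decidability of reachability may be assumed
    ¬¬-∀-Fin (λ u → ¬¬-∀-Fin λ v → ¬¬-excluded-middle) λ reach? →
      let s = λ i → source-preimage reach? (t-src i)
      in  sources≤c (proj₁ ∘ s) (proj₁ ∘ proj₂ ∘ s) λ i j sᵢ~sⱼ →
            t-distinct i j (SameSCC⇒SameHyperedge H
              (SameSCC-trans H (SameSCC-sym H (proj₂ (proj₂ (s i))))
                (SameSCC-trans H (sameSCC sᵢ~sⱼ) (proj₂ (proj₂ (s j))))))

lemma40 : (H : Digraph) (c : ℕ) → SourcesAtMost H c →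
    (H₂ : Digraph) → ArcSupergraph H H₂ →
    (m : ℕ) (q : Fin (n H₂) → Fin m) → Surjective _≡_ _≡_ q →
    ReachHypergraphAtMost (Quotient H₂ m q) c
lemma40 H c sources≤c H₂ H⊆H₂ m q q-surj =
  ReachHypergraphAtMost-image
    (quotient-epimorphism H₂ m q-surj ∘ᴱ ArcSupergraph⇒Epimorphism H⊆H₂)
    sources≤c
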